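{- Let $n\in\mathbb{N}$ and let $w_0=[-1,-2,\dots,-n]\in B_n$ (i.e. $w_0(j)=-j$ for all $j$) be the longest element. Then for all $w\in B_n$, $$L(ww_0)=L(w_0w)=L(w_0)-L(w).$$ Moreover, the identity is the only element $w\in B_n$ with $L(w)=0$, and $w_0$ is the unique element of $B_n$ on which $L$ attains its maximum, which equals $\binom{n+1}{2}$.
   Context: For $n\in\mathbb{N}$ let $[\pm n]_0=\{ -n,\dots,n\}$. $B_n$ is the group of permutations $w$ of $[\pm n]_0$ with $w(-j)=-w(j)$ for all $j$, with composition of maps as the group operation. For $w\in B_n$ define $L(w)=\tfrac12\#\{(i,j)\in[\pm n]_0^2: i<j,\ w(i)>w(j),\ i\not\equiv j\pmod 2\}$. -}

module Defs where

open import Data.Nat as ℕ using (ℕ; zero; suc; _∸_; ⌊_/2⌋; _%_)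
import Data.Nat.Properties as ℕP
open import Data.Fin as Fin using (Fin; toℕ; opposite)
open import Data.Fin.Properties using (opposite-prop; opposite-involutive; toℕ<n)
open import Data.Fin.Permutation as Perm using (Permutation′; _⟨$⟩ʳ_; _⟨$⟩ˡ_; _∘ₚ_; permutation)
open import Data.Integer as ℤ using (ℤ; +_; -_; _-_)
import Data.Integer.Properties as ℤP
open import Data.List using (List; length; filter; cartesianProduct; allFin)
open import Data.Product using (_×_; _,_; proj₁; proj₂)
open import Relation.Binary.PropositionalEquality
open import Relation.Nullary using (Dec; ¬_)
open import Relation.Nullary.Decidable using (_×-dec_)
import Data.Nat.Properties as NP

-- The index set [±n]_0 = {-n,…,n} is encoded as Fin (2n+1) = Fin (suc (n + n)),
-- where k : Fin (suc (n + n)) stands for the integer  toℕ k - n.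
Idx : ℕ → Set
Idx n = Fin (suc (n ℕ.+ n))

val : {n : ℕ} → Idx n → ℤ
val {n} k = + toℕ k - + n

record B (n : ℕ) : Set where
  constructor mkB
  field
    perm : Permutation′ (suc (n ℕ.+ n))
    odd  : ∀ (i j : Idx n) → val {n} i ≡ - val {n} j → val {n} (perm ⟨$⟩ʳ i) ≡ - val {n} (perm ⟨$⟩ʳ j)

open B public

_⟨_⟩ : {n : ℕ} → B n → Idx n → Idx n
w ⟨ i ⟩ = perm w ⟨$⟩ʳ i

-- group operation: composition of maps, (w · v)(i) = w(v(i))
_·_ : {n : ℕ} → B n → B n → B n
w · v = mkB (perm v ∘ₚ perm w)
            (λ i j e → odd w _ _ (odd v i j e))

idB : {n : ℕ} → B n
idB = mkB Perm.id (λ i j e → e)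

val-opposite : {n : ℕ} (i : Idx n) → val {n} (opposite i) ≡ - val {n} i
val-opposite {n} i = begin
    + toℕ (opposite i) - + n
  ≡⟨ cong (λ x → + x - + n) (opposite-prop i) ⟩
    + ((n ℕ.+ n) ∸ toℕ i) - + n
  ≡⟨ cong (λ x → x - + n) (sym (ℤP.⊖-≥ (ℕP.≤-pred (toℕ<n i)))) ⟩
    ((n ℕ.+ n) ℤ.⊖ toℕ i) - + n
  ≡⟨ cong (λ x → x - + n) (sym (ℤP.m-n≡m⊖n (n ℕ.+ n) (toℕ i))) ⟩
    (+ (n ℕ.+ n) - + toℕ i) - + n
  ≡⟨ cong (λ x → (x - + toℕ i) - + n) (ℤP.pos-+ n n) ⟩
    ((+ n ℤ.+ + n) - + toℕ i) - + n
  ≡⟨ lemma (+ n) (+ toℕ i) ⟩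
    - (+ toℕ i - + n)
  ∎
  where
  open ≡-Reasoning
  open import Data.Integer.Solver using (module +-*-Solver)
  open +-*-Solver
  lemma : ∀ (a b : ℤ) → ((a ℤ.+ a) - b) - a ≡ - (b - a)
  lemma = solve 2 (λ a b → ((a :+ a) :- b) :- a := :- (b :- a)) refl

w₀ : {n : ℕ} → B n
w₀ {n} = mkB (permutation opposite opposite opposite-involutive opposite-involutive)
         (λ i j e → trans (val-opposite {n} i)
                    (trans (cong -_ e) (sym (cong -_ (val-opposite {n} j)))))

DiffParity : {n : ℕ} → Idx n → Idx n → Set
DiffParity {n} i j = ℤ.∣ val {n} i - val {n} j ∣ % 2 ≡ 1

LPair : {n : ℕ} → B n → Idx n × Idx n → Set
LPair {n} w (i , j) = (val {n} i ℤ.< val {n} j) × (val {n} (w ⟨ j ⟩) ℤ.< val {n} (w ⟨ i ⟩)) × DiffParity {n} i j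

LPair? : {n : ℕ} (w : B n) (p : Idx n × Idx n) → Dec (LPair w p)
LPair? {n} w (i , j) = (val {n} i ℤ.<? val {n} j) ×-dec ((val {n} (w ⟨ j ⟩) ℤ.<? val {n} (w ⟨ i ⟩))
                     ×-dec (ℤ.∣ val {n} i - val {n} j ∣ % 2 ℕ.≟ 1))

allPairs : (n : ℕ) → List (Idx n × Idx n)
allPairs n = cartesianProduct (allFin _) (allFin _)

L : {n : ℕ} → B n → ℕ
L {n} w = ⌊ length (filter (LPair? w) (allPairs n)) /2⌋

module Submission where

-- Let Inv w be the number of ordered pairs (i , j) counted by L,
-- so that L w = ⌊ Inv w /2⌋.  Writing Inv w as a double sum of 0/1 indicators
-- over [±n]_0², every statement about Inv reduces to a pointwise statement
-- about a single pair (i , j):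
--   * since w(-i) = -w(i), the inverted pairs are symmetric under
--     (i , j) ↦ (-j , -i), and no counted pair is fixed by this reflection
--     (i = -j forces i ≡ j mod 2); hence Inv w is even and Inv w = 2 L w;
--   * for an odd-distance pair i < j exactly one of w and w₀w inverts it, so
--     Inv w + Inv (w₀w) = Inv w₀; moreover ww₀ = w₀w as maps;
--   * Inv w₀ counts all odd-distance pairs i < j, which is 2 C(n+1,2);
--   * if L w = 0 then w increases on each adjacent pair (i , i+1), and an
--     increasing self-map of a finite chain is the identity.

open import Defs
open import Data.Nat as ℕ using (ℕ; zero; suc; _∸_; _≤_; _<_; _+_; ⌊_/2⌋; _%_; s≤s; z≤n)
import Data.Nat.Properties as ℕP
import Data.Nat.DivMod as ℕDivMod
open import Data.Nat.Combinatorics using (_C_; nC1≡n; nCk+nC[k+1]≡[n+1]C[k+1])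
open import Data.Fin as Fin using (Fin; toℕ; opposite; fromℕ; inject₁)
import Data.Fin.Properties as FinP
open import Data.Fin.Permutation as Perm using (Permutation′; _⟨$⟩ˡ_)
open import Data.Integer as ℤ using (ℤ; +_; -_; _-_; _⊖_; ∣_∣)
import Data.Integer.Properties as ℤP
open import Data.List as List using (List; []; _∷_; length; filter; map; tabulate; allFin; cartesianProduct)
import Data.List.Properties as ListP
open import Data.Nat.ListAction using () renaming (sum to listSum)
import Data.Nat.ListAction.Properties as ListActionP
import Data.List.Relation.Unary.All as All
open import Data.Product using (_×_; _,_)
open import Data.Sum using (_⊎_; inj₁; inj₂)
open import Data.Empty using (⊥; ⊥-elim)
open import Data.Bool using (true; false)
open import Function using (_∘_)
open import Function.Bundles using (_⇔_; mk⇔; module Equivalence)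
open import Relation.Binary.PropositionalEquality
open import Relation.Binary.Definitions using (tri<; tri≈; tri>)
open import Relation.Nullary using (Dec; yes; no; _because_; ¬_)
open import Relation.Nullary.Decidable using (_×-dec_)
open import Algebra.Properties.CommutativeMonoid.Sum ℕP.+-0-commutativeMonoid
  using (sum; ∑-comm; ∑-permute; ∑-distrib-+; sum-cong-≗)
open import Algebra.Properties.CommutativeSemigroup ℕP.+-commutativeSemigroup
  using (interchange)

open Equivalence using (to; from)

𝟙 : {P : Set} → Dec P → ℕ
𝟙 (true  because _) = 1
𝟙 (false because _) = 0

𝟙-char : {P : Set} (p : Dec P) {k : ℕ} → (P → k ≡ 1) → (¬ P → k ≡ 0) → 𝟙 p ≡ k
𝟙-char (yes x) onP on¬P = sym (onP x)
𝟙-char (no ¬x) onP on¬P = sym (on¬P ¬x)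

𝟙-yes : {P : Set} (p : Dec P) → P → 𝟙 p ≡ 1
𝟙-yes p x = 𝟙-char p (λ _ → refl) (λ ¬x → ⊥-elim (¬x x))

𝟙-no : {P : Set} (p : Dec P) → ¬ P → 𝟙 p ≡ 0
𝟙-no p ¬x = 𝟙-char p (λ x → ⊥-elim (¬x x)) (λ _ → refl)

𝟙-cong : {P Q : Set} (p : Dec P) (q : Dec Q) → P ⇔ Q → 𝟙 p ≡ 𝟙 q
𝟙-cong (yes x) q P⇔Q = sym (𝟙-yes q (to P⇔Q x))
𝟙-cong (no ¬x) q P⇔Q = sym (𝟙-no q (¬x ∘ from P⇔Q))

𝟙-split : {P Q R : Set} (p : Dec P) (q : Dec Q) (r : Dec R) →
          (P → Q ⊎ R) → (Q → R → ⊥) → 𝟙 p ≡ 𝟙 (p ×-dec q) + 𝟙 (p ×-dec r)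
𝟙-split (no _)  q       r       cover disjoint = refl
𝟙-split (yes x) (yes y) (yes z) cover disjoint = ⊥-elim (disjoint y z)
𝟙-split (yes x) (yes y) (no _)  cover disjoint = refl
𝟙-split (yes x) (no _)  (yes z) cover disjoint = refl
𝟙-split (yes x) (no ¬y) (no ¬z) cover disjoint with cover x
... | inj₁ y = ⊥-elim (¬y y)
... | inj₂ z = ⊥-elim (¬z z)

length-filter-sum : {A : Set} {P : A → Set} (P? : ∀ x → Dec (P x)) (xs : List A) →
                    length (filter P? xs) ≡ listSum (map (𝟙 ∘ P?) xs)
length-filter-sum P? []       = refl
length-filter-sum P? (x ∷ xs) with P? x
... | yes _ = cong suc (length-filter-sum P? xs)
... | no  _ = length-filter-sum P? xs

sum-tabulate : {A : Set} (m : ℕ) (g : Fin m → A) (f : A → ℕ) →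
               listSum (map f (tabulate g)) ≡ sum (f ∘ g)
sum-tabulate zero    g f = refl
sum-tabulate (suc m) g f = cong (λ x → f (g Fin.zero) + x) (sum-tabulate m (g ∘ Fin.suc) f)

sum-cartesianProduct : {A B : Set} (f : A × B → ℕ) (xs : List A) (ys : List B) →
  listSum (map f (cartesianProduct xs ys)) ≡ listSum (map (λ x → listSum (map (λ y → f (x , y)) ys)) xs)
sum-cartesianProduct f []       ys = refl
sum-cartesianProduct f (x ∷ xs) ys = begin
    listSum (map f (map (x ,_) ys List.++ cartesianProduct xs ys))
  ≡⟨ cong listSum (ListP.map-++ f (map (x ,_) ys) _) ⟩
    listSum (map f (map (x ,_) ys) List.++ map f (cartesianProduct xs ys))
  ≡⟨ ListActionP.sum-++ (map f (map (x ,_) ys)) _ ⟩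
    listSum (map f (map (x ,_) ys)) + listSum (map f (cartesianProduct xs ys))
  ≡⟨ cong₂ _+_ (cong listSum (sym (ListP.map-∘ ys))) (sum-cartesianProduct f xs ys) ⟩
    listSum (map (λ y → f (x , y)) ys) + listSum (map (λ x → listSum (map (λ y → f (x , y)) ys)) xs)
  ∎
  where open ≡-Reasoning

ΣΣ : {m : ℕ} → (Fin m → Fin m → ℕ) → ℕ
ΣΣ K = sum (λ i → sum (λ j → K i j))

count-pairs : {m : ℕ} {P : Fin m × Fin m → Set} (P? : ∀ p → Dec (P p)) →
              length (filter P? (cartesianProduct (allFin m) (allFin m))) ≡ ΣΣ (λ i j → 𝟙 (P? (i , j)))
count-pairs {m} P? = begin
    length (filter P? (cartesianProduct (allFin m) (allFin m)))
  ≡⟨ length-filter-sum P? (cartesianProduct (allFin m) (allFin m)) ⟩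
    listSum (map (𝟙 ∘ P?) (cartesianProduct (allFin m) (allFin m)))
  ≡⟨ sum-cartesianProduct (𝟙 ∘ P?) (allFin m) (allFin m) ⟩
    listSum (map (λ i → listSum (map (λ j → 𝟙 (P? (i , j))) (allFin m))) (allFin m))
  ≡⟨ sum-tabulate m (λ i → i) _ ⟩
    sum (λ i → listSum (map (λ j → 𝟙 (P? (i , j))) (allFin m)))
  ≡⟨ sum-cong-≗ (λ i → sum-tabulate m (λ j → j) (λ j → 𝟙 (P? (i , j)))) ⟩
    ΣΣ (λ i j → 𝟙 (P? (i , j)))
  ∎
  where open ≡-Reasoning

ΣΣ-cong : {m : ℕ} {K M : Fin m → Fin m → ℕ} → (∀ i j → K i j ≡ M i j) → ΣΣ K ≡ ΣΣ M
ΣΣ-cong K≗M = sum-cong-≗ (λ i → sum-cong-≗ (K≗M i))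

ΣΣ-+ : {m : ℕ} (K M : Fin m → Fin m → ℕ) → ΣΣ (λ i j → K i j + M i j) ≡ ΣΣ K + ΣΣ M
ΣΣ-+ K M = trans (sum-cong-≗ (λ i → ∑-distrib-+ (K i) (M i)))
                 (∑-distrib-+ (λ i → sum (K i)) (λ i → sum (M i)))

ΣΣ-reflect : {m : ℕ} (π : Permutation′ m) (K : Fin m → Fin m → ℕ) →
             ΣΣ (λ i j → K (π Perm.⟨$⟩ʳ j) (π Perm.⟨$⟩ʳ i)) ≡ ΣΣ K
ΣΣ-reflect π K = begin
    ΣΣ (λ i j → K (π Perm.⟨$⟩ʳ j) (π Perm.⟨$⟩ʳ i))
  ≡⟨ ∑-comm (λ i j → K (π Perm.⟨$⟩ʳ j) (π Perm.⟨$⟩ʳ i)) ⟩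
    ΣΣ (λ j i → K (π Perm.⟨$⟩ʳ j) (π Perm.⟨$⟩ʳ i))
  ≡⟨ sum-cong-≗ (λ j → sym (∑-permute (K (π Perm.⟨$⟩ʳ j)) π)) ⟩
    sum (λ j → sum (K (π Perm.⟨$⟩ʳ j)))
  ≡⟨ sym (∑-permute (λ j → sum (K j)) π) ⟩
    ΣΣ K
  ∎
  where open ≡-Reasoning

sum≡0 : {m : ℕ} (f : Fin m → ℕ) → sum f ≡ 0 → ∀ i → f i ≡ 0
sum≡0 f e Fin.zero    = ℕP.m+n≡0⇒m≡0 (f Fin.zero) e
sum≡0 f e (Fin.suc i) = sum≡0 (f ∘ Fin.suc) (ℕP.m+n≡0⇒n≡0 (f Fin.zero) e) i

ΣΣ≡0 : {m : ℕ} (K : Fin m → Fin m → ℕ) → ΣΣ K ≡ 0 → ∀ i j → K i j ≡ 0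
ΣΣ≡0 K e i = sum≡0 (K i) (sum≡0 (λ k → sum (K k)) e i)

double-injective : ∀ {a b} → a + a ≡ b + b → a ≡ b
double-injective {a} {b} e = trans (ℕP.n≡⌊n+n/2⌋ a) (trans (cong ⌊_/2⌋ e) (sym (ℕP.n≡⌊n+n/2⌋ b)))

parity : ℕ → ℕ
parity zero          = 0
parity (suc zero)    = 1
parity (suc (suc k)) = parity k

parity-% : ∀ k → k % 2 ≡ parity k
parity-% zero          = refl
parity-% (suc zero)    = refl
parity-% (suc (suc k)) = trans (cong (_% 2) (ℕP.+-comm 2 k)) (trans (ℕDivMod.[m+n]%n≡m%n k 2) (parity-% k))

parity-01 : ∀ k → parity k ≡ 0 ⊎ parity k ≡ 1
parity-01 zero          = inj₁ refl
parity-01 (suc zero)    = inj₂ refl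
parity-01 (suc (suc k)) = parity-01 k

∣m⊖1+m∣≡1 : ∀ m → ∣ m ⊖ suc m ∣ ≡ 1
∣m⊖1+m∣≡1 zero    = refl
∣m⊖1+m∣≡1 (suc m) = trans (cong ∣_∣ (ℤP.[1+m]⊖[1+n]≡m⊖n m (suc m))) (∣m⊖1+m∣≡1 m)

oddGap : ℕ → ℕ → ℕ
oddGap zero    zero    = 0
oddGap zero    (suc b) = parity (suc b)
oddGap (suc a) zero    = 0
oddGap (suc a) (suc b) = oddGap a b

OddGap : ℕ → ℕ → Set
OddGap a b = a < b × parity ∣ a ⊖ b ∣ ≡ 1

oddGap-yes : ∀ a b → OddGap a b → oddGap a b ≡ 1
oddGap-yes zero    (suc b) (_ , odd)         = odd
oddGap-yes (suc a) (suc b) (s≤s a<b , odd) =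
  oddGap-yes a b (a<b , trans (cong (parity ∘ ∣_∣) (sym (ℤP.[1+m]⊖[1+n]≡m⊖n a b))) odd)

oddGap-no : ∀ a b → ¬ OddGap a b → oddGap a b ≡ 0
oddGap-no zero    zero    _ = refl
oddGap-no (suc a) zero    _ = refl
oddGap-no zero    (suc b) ¬gap with parity-01 (suc b)
... | inj₁ even = even
... | inj₂ odd  = ⊥-elim (¬gap (s≤s z≤n , odd))
oddGap-no (suc a) (suc b) ¬gap = oddGap-no a b λ (a<b , odd) →
  ¬gap (s≤s a<b , trans (cong (parity ∘ ∣_∣) (ℤP.[1+m]⊖[1+n]≡m⊖n a b)) odd)

-- oddPairs m = #{(a , b) : a < b < m, b - a odd};
-- oddAbove m = #{b : 0 < b ≤ m, b odd}.  Adding 0 as a new smallest element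
-- gives the recursion oddPairs (1 + m) = oddAbove m + oddPairs m.
oddPairs : ℕ → ℕ
oddPairs m = ΣΣ {m} (λ i j → oddGap (toℕ i) (toℕ j))

oddAbove : ℕ → ℕ
oddAbove m = sum {m} (λ j → parity (suc (toℕ j)))

oddAbove-even : ∀ k → oddAbove (k + k) ≡ k
oddAbove-even zero    = refl
oddAbove-even (suc k) = trans (cong (oddAbove ∘ suc) (ℕP.+-suc k k)) (cong suc (oddAbove-even k))

oddAbove-odd : ∀ k → oddAbove (suc (k + k)) ≡ suc k
oddAbove-odd zero    = refl
oddAbove-odd (suc k) = trans (cong (oddAbove ∘ suc ∘ suc) (ℕP.+-suc k k)) (cong suc (oddAbove-odd k))

oddPairs-value : ∀ n → oddPairs (suc (n + n)) ≡ suc n C 2 + suc n C 2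
oddPairs-value zero    = refl
oddPairs-value (suc n) = begin
    oddPairs (suc (suc n + suc n))
  ≡⟨ cong (oddPairs ∘ suc ∘ suc) (ℕP.+-suc n n) ⟩
    oddAbove (suc (suc (n + n))) + (oddAbove (suc (n + n)) + oddPairs (suc (n + n)))
  ≡⟨ cong₂ (λ x y → suc x + (y + oddPairs (suc (n + n)))) (oddAbove-even n) (oddAbove-odd n) ⟩
    suc n + (suc n + oddPairs (suc (n + n)))
  ≡⟨ cong (λ x → suc n + (suc n + x)) (oddPairs-value n) ⟩
    suc n + (suc n + (c + c))
  ≡⟨ sym (ℕP.+-assoc (suc n) (suc n) (c + c)) ⟩
    (suc n + suc n) + (c + c)
  ≡⟨ interchange (suc n) (suc n) c c ⟩
    (suc n + c) + (suc n + c)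
  ≡⟨ cong₂ _+_ pascal pascal ⟩
    suc (suc n) C 2 + suc (suc n) C 2
  ∎
  where
  open ≡-Reasoning
  c : ℕ
  c = suc n C 2
  pascal : suc n + c ≡ suc (suc n) C 2
  pascal = trans (cong (_+ c) (sym (nC1≡n (suc n)))) (nCk+nC[k+1]≡[n+1]C[k+1] (suc n) 1)

-- A finite chain has no increasing self-map other than the identity

module _ {N : ℕ} (h : Fin (suc N) → ℕ) (step : ∀ i j → toℕ j ≡ suc (toℕ i) → h i < h j) where

  increase : ∀ d (i j : Fin (suc N)) → toℕ j ≡ toℕ i + d → h i + d ≤ h j
  increase zero i j e
    rewrite ℕP.+-identityʳ (h i) | FinP.toℕ-injective (trans e (ℕP.+-identityʳ (toℕ i))) = ℕP.≤-refl
  increase (suc d) i Fin.zero e with trans e (ℕP.+-suc (toℕ i) d)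
  ... | ()
  increase (suc d) i (Fin.suc j) e = begin
      h i + suc d          ≡⟨ ℕP.+-suc (h i) d ⟩
      suc (h i + d)        ≤⟨ s≤s (increase d i (inject₁ j) previous) ⟩
      suc (h (inject₁ j))  ≤⟨ step (inject₁ j) (Fin.suc j) (cong suc (sym (FinP.toℕ-inject₁ j))) ⟩
      h (Fin.suc j)        ∎
    where
    open ℕP.≤-Reasoning
    previous : toℕ (inject₁ j) ≡ toℕ i + d
    previous = trans (FinP.toℕ-inject₁ j) (ℕP.suc-injective (trans e (ℕP.+-suc (toℕ i) d)))

  increasing⇒toℕ : (∀ i → h i ≤ N) → ∀ i → h i ≡ toℕ i
  increasing⇒toℕ bounded i = ℕP.≤-antisym upper lower
    where
    lower : toℕ i ≤ h i
    lower = ℕP.≤-trans (ℕP.m≤n+m (toℕ i) (h Fin.zero)) (increase (toℕ i) Fin.zero i refl)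
    rest : N ≡ toℕ i + (N ∸ toℕ i)
    rest = sym (ℕP.m+[n∸m]≡n (ℕP.≤-pred (FinP.toℕ<n i)))
    upper : h i ≤ toℕ i
    upper = ℕP.+-cancelʳ-≤ (N ∸ toℕ i) (h i) (toℕ i)
      (subst (h i + (N ∸ toℕ i) ≤_) rest
        (ℕP.≤-trans (increase (N ∸ toℕ i) i (fromℕ N) (trans (FinP.toℕ-fromℕ N) rest)) (bounded (fromℕ N))))

module IntegerIdentities where
  open import Data.Integer.Solver using (module +-*-Solver)
  open +-*-Solver

  sub-add : ∀ x y → (x - y) ℤ.+ y ≡ x
  sub-add = solve 2 (λ x y → (x :- y) :+ y := x) refl

  shift-diff : ∀ x y z → (x - z) - (y - z) ≡ x - y
  shift-diff = solve 3 (λ x y z → (x :- z) :- (y :- z) := x :- y) refl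

  neg-diff : ∀ x y → (- y) - (- x) ≡ x - y
  neg-diff = solve 2 (λ x y → (:- y) :- (:- x) := x :- y) refl

  neg-double : ∀ y → (- y) - y ≡ (- y) ℤ.* + 2
  neg-double = solve 1 (λ y → (:- y) :- y := (:- y) :* con (+ 2)) refl

open IntegerIdentities

<-negated : ∀ {a b x y : ℤ} → a ≡ - x → b ≡ - y → (a ℤ.< b) ⇔ (y ℤ.< x)
<-negated {x = x} {y} refl refl =
  mk⇔ (λ lt → subst₂ ℤ._<_ (ℤP.neg-involutive y) (ℤP.neg-involutive x) (ℤP.neg-mono-< lt))
      ℤP.neg-mono-<

trichotomy : ∀ (x y : ℤ) → x ≢ y → x ℤ.< y ⊎ y ℤ.< x
trichotomy x y x≢y with ℤP.<-cmp x y
... | tri< lt _ _ = inj₁ lt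
... | tri≈ _ e _  = ⊥-elim (x≢y e)
... | tri> _ _ gt = inj₂ gt

module _ {n : ℕ} where
  private
    v : Idx n → ℤ
    v = val {n}
    ω : B n
    ω = w₀ {n}

  val-injective : ∀ {i j} → v i ≡ v j → i ≡ j
  val-injective {i} {j} e = FinP.toℕ-injective (ℤP.+-injective
    (trans (sym (sub-add (+ toℕ i) (+ n))) (trans (cong (ℤ._+ + n) e) (sub-add (+ toℕ j) (+ n)))))

  val-<⇒toℕ-< : ∀ {i j} → v i ℤ.< v j → toℕ i < toℕ j
  val-<⇒toℕ-< {i} {j} lt =
    ℤP.drop‿+<+ (subst₂ ℤ._<_ (sub-add (+ toℕ i) (+ n)) (sub-add (+ toℕ j) (+ n)) (ℤP.+-monoˡ-< (+ n) lt))

  toℕ-<⇒val-< : ∀ {i j} → toℕ i < toℕ j → v i ℤ.< v j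
  toℕ-<⇒val-< lt = ℤP.+-monoˡ-< (- + n) (ℤ.+<+ lt)

  val-diff : ∀ i j → v i - v j ≡ toℕ i ⊖ toℕ j
  val-diff i j = trans (shift-diff (+ toℕ i) (+ toℕ j) (+ n)) (ℤP.m-n≡m⊖n (toℕ i) (toℕ j))

  B-injective : (w : B n) → ∀ {i j} → w ⟨ i ⟩ ≡ w ⟨ j ⟩ → i ≡ j
  B-injective w {i} {j} e =
    trans (sym (Perm.inverseˡ (perm w))) (trans (cong (perm w ⟨$⟩ˡ_) e) (Perm.inverseˡ (perm w)))

  B-odd : (w : B n) (i : Idx n) → v (w ⟨ opposite i ⟩) ≡ - v (w ⟨ i ⟩)
  B-odd w i = odd w (opposite i) i (val-opposite {n} i)

  w₀-central : (w : B n) (i : Idx n) → (w · ω) ⟨ i ⟩ ≡ (ω · w) ⟨ i ⟩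
  w₀-central w i = val-injective (trans (B-odd w i) (sym (val-opposite {n} (w ⟨ i ⟩))))

  DiffParity-reflect : ∀ {i j} → DiffParity {n} i j → DiffParity {n} (opposite j) (opposite i)
  DiffParity-reflect {i} {j} = subst (λ d → ∣ d ∣ % 2 ≡ 1) (sym reflected)
    where
    reflected : v (opposite j) - v (opposite i) ≡ v i - v j
    reflected = trans (cong₂ _-_ (val-opposite {n} j) (val-opposite {n} i)) (neg-diff (v i) (v j))

  antidiagonal-even : ∀ {i j} → v i ≡ - v j → ¬ DiffParity {n} i j
  antidiagonal-even {i} {j} e dp = 0≢1 (begin
      0
    ≡⟨ sym (ℕDivMod.m*n%n≡0 ∣ - v j ∣ 2) ⟩
      (∣ - v j ∣ ℕ.* 2) % 2
    ≡⟨ cong (_% 2) (sym (ℤP.abs-* (- v j) (+ 2))) ⟩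
      ∣ (- v j) ℤ.* + 2 ∣ % 2
    ≡⟨ cong (λ d → ∣ d ∣ % 2) (sym twice) ⟩
      ∣ v i - v j ∣ % 2
    ≡⟨ dp ⟩
      1
    ∎)
    where
    open ≡-Reasoning
    twice : v i - v j ≡ (- v j) ℤ.* + 2
    twice = trans (cong (_- v j) e) (neg-double (v j))
    0≢1 : 0 ≢ 1
    0≢1 ()

  adjacent-odd : ∀ {i j} → toℕ j ≡ suc (toℕ i) → DiffParity {n} i j
  adjacent-odd {i} {j} e =
    cong (_% 2) (trans (cong ∣_∣ (trans (val-diff i j) (cong (toℕ i ⊖_) e))) (∣m⊖1+m∣≡1 (toℕ i)))

  DiffParity⇔parity : ∀ {i j} → DiffParity {n} i j ⇔ (parity ∣ toℕ i ⊖ toℕ j ∣ ≡ 1)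
  DiffParity⇔parity {i} {j} = mk⇔ (trans (sym via-parity)) (trans via-parity)
    where
    via-parity : ∣ v i - v j ∣ % 2 ≡ parity ∣ toℕ i ⊖ toℕ j ∣
    via-parity = trans (cong (λ d → ∣ d ∣ % 2) (val-diff i j)) (parity-% ∣ toℕ i ⊖ toℕ j ∣)

  Inv : B n → ℕ
  Inv w = length (filter (LPair? w) (allPairs n))

  inv : B n → Idx n → Idx n → ℕ
  inv w i j = 𝟙 (LPair? w (i , j))

  Inv-ΣΣ : (w : B n) → Inv w ≡ ΣΣ (inv w)
  Inv-ΣΣ w = count-pairs (LPair? w)

  Inv-cong : (u u' : B n) → (∀ i → u ⟨ i ⟩ ≡ u' ⟨ i ⟩) → Inv u ≡ Inv u'
  Inv-cong u u' u≗u' = cong length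
    (ListP.filter-≐ (LPair? u) (LPair? u') (transport {u} {u'} u≗u' , transport {u'} {u} (sym ∘ u≗u')) (allPairs n))
    where
    transport : ∀ {x y : B n} → (∀ i → x ⟨ i ⟩ ≡ y ⟨ i ⟩) → ∀ {p} → LPair x p → LPair y p
    transport x≗y {i , j} (lt , inverted , dp) = lt , subst₂ (λ a b → v a ℤ.< v b) (x≗y j) (x≗y i) inverted , dp

  LPair-reflect : (w : B n) → ∀ {i j} → LPair w (opposite j , opposite i) ⇔ LPair w (i , j)
  LPair-reflect w {i} {j} = mk⇔
    (λ (lt , inverted , dp) →
      to (<-negated (val-opposite {n} j) (val-opposite {n} i)) lt ,
      to (<-negated (B-odd w i) (B-odd w j)) inverted ,
      subst₂ (DiffParity {n}) (FinP.opposite-involutive i) (FinP.opposite-involutive j) (DiffParity-reflect dp))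
    (λ (lt , inverted , dp) →
      from (<-negated (val-opposite {n} j) (val-opposite {n} i)) lt ,
      from (<-negated (B-odd w i) (B-odd w j)) inverted ,
      DiffParity-reflect dp)

  -- Counted pairs strictly below / above the antidiagonal i = -j.
  below above : B n → Idx n → Idx n → ℕ
  below w i j = 𝟙 (LPair? w (i , j) ×-dec (v i ℤ.<? - v j))
  above w i j = 𝟙 (LPair? w (i , j) ×-dec (- v j ℤ.<? v i))

  -- No counted pair lies on the antidiagonal.
  below+above : (w : B n) (i j : Idx n) → inv w i j ≡ below w i j + above w i j
  below+above w i j = 𝟙-split (LPair? w (i , j)) _ _
    (λ (_ , _ , dp) → trichotomy (v i) (- v j) (λ e → antidiagonal-even e dp))
    ℤP.<-asym

  above-reflect : (w : B n) (i j : Idx n) → above w (opposite j) (opposite i) ≡ below w i j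
  above-reflect w i j = 𝟙-cong _ _ (mk⇔
    (λ (counted , gt) → to (LPair-reflect w) counted , to side gt)
    (λ (counted , lt) → from (LPair-reflect w) counted , from side lt))
    where
    side : (- v (opposite i) ℤ.< v (opposite j)) ⇔ (v i ℤ.< - v j)
    side = mk⇔ (subst₂ ℤ._<_ e₁ e₂) (subst₂ ℤ._<_ (sym e₁) (sym e₂))
      where
      e₁ : - v (opposite i) ≡ v i
      e₁ = trans (cong -_ (val-opposite {n} i)) (ℤP.neg-involutive (v i))
      e₂ : v (opposite j) ≡ - v j
      e₂ = val-opposite {n} j

  -- Splitting along the antidiagonal and reflecting one half onto the other.
  Inv-even : (w : B n) → Inv w ≡ ΣΣ (below w) + ΣΣ (below w)
  Inv-even w = begin
      Inv w
    ≡⟨ Inv-ΣΣ w ⟩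
      ΣΣ (inv w)
    ≡⟨ ΣΣ-cong (below+above w) ⟩
      ΣΣ (λ i j → below w i j + above w i j)
    ≡⟨ ΣΣ-+ (below w) (above w) ⟩
      ΣΣ (below w) + ΣΣ (above w)
    ≡⟨ cong (λ x → ΣΣ (below w) + x) (sym (ΣΣ-reflect (perm ω) (above w))) ⟩
      ΣΣ (below w) + ΣΣ (λ i j → above w (opposite j) (opposite i))
    ≡⟨ cong (λ x → ΣΣ (below w) + x) (ΣΣ-cong (above-reflect w)) ⟩
      ΣΣ (below w) + ΣΣ (below w)
    ∎
    where open ≡-Reasoning

  Inv-double : (w : B n) → Inv w ≡ L w + L w
  Inv-double w = trans (Inv-even w) (cong (λ m → m + m) half)
    where
    half : ΣΣ (below w) ≡ L w
    half = trans (ℕP.n≡⌊n+n/2⌋ _) (cong ⌊_/2⌋ (sym (Inv-even w)))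

  LPair-w₀ : ∀ {i j} → LPair ω (i , j) ⇔ (v i ℤ.< v j × DiffParity {n} i j)
  LPair-w₀ {i} {j} = mk⇔ (λ (lt , _ , dp) → lt , dp)
    (λ (lt , dp) → lt , from (<-negated (val-opposite {n} j) (val-opposite {n} i)) lt , dp)

  inv-complement : (w : B n) (i j : Idx n) → inv w i j + inv (ω · w) i j ≡ inv ω i j
  inv-complement w i j = sym (begin
      inv ω i j
    ≡⟨ 𝟙-split (LPair? ω (i , j)) inverted? ordered? cover ℤP.<-asym ⟩
      𝟙 (LPair? ω (i , j) ×-dec inverted?) + 𝟙 (LPair? ω (i , j) ×-dec ordered?)
    ≡⟨ cong₂ _+_ (𝟙-cong (LPair? ω (i , j) ×-dec inverted?) (LPair? w (i , j)) by-w)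
                   (𝟙-cong (LPair? ω (i , j) ×-dec ordered?) (LPair? (ω · w) (i , j)) by-w₀w) ⟩
      inv w i j + inv (ω · w) i j
    ∎)
    where
    open ≡-Reasoning
    inverted? : Dec (v (w ⟨ j ⟩) ℤ.< v (w ⟨ i ⟩))
    inverted? = v (w ⟨ j ⟩) ℤ.<? v (w ⟨ i ⟩)
    ordered? : Dec (v (w ⟨ i ⟩) ℤ.< v (w ⟨ j ⟩))
    ordered? = v (w ⟨ i ⟩) ℤ.<? v (w ⟨ j ⟩)
    cover : LPair ω (i , j) → v (w ⟨ j ⟩) ℤ.< v (w ⟨ i ⟩) ⊎ v (w ⟨ i ⟩) ℤ.< v (w ⟨ j ⟩)
    cover (lt , _) = trichotomy _ _ λ e → ℤP.<-irrefl (cong v (sym (B-injective w (val-injective e)))) lt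
    by-w : (LPair ω (i , j) × v (w ⟨ j ⟩) ℤ.< v (w ⟨ i ⟩)) ⇔ LPair w (i , j)
    by-w = mk⇔ (λ ((lt , _ , dp) , inverted) → lt , inverted , dp)
               (λ (lt , inverted , dp) → from LPair-w₀ (lt , dp) , inverted)
    by-w₀w : (LPair ω (i , j) × v (w ⟨ i ⟩) ℤ.< v (w ⟨ j ⟩)) ⇔ LPair (ω · w) (i , j)
    by-w₀w = mk⇔ (λ ((lt , _ , dp) , ordered) → lt , from reversed ordered , dp)
                 (λ (lt , inverted , dp) → from LPair-w₀ (lt , dp) , to reversed inverted)
      where
      reversed : (v (opposite (w ⟨ j ⟩)) ℤ.< v (opposite (w ⟨ i ⟩))) ⇔ (v (w ⟨ i ⟩) ℤ.< v (w ⟨ j ⟩))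
      reversed = <-negated (val-opposite {n} (w ⟨ j ⟩)) (val-opposite {n} (w ⟨ i ⟩))

  Inv-complement : (w : B n) → Inv w + Inv (ω · w) ≡ Inv ω
  Inv-complement w = begin
      Inv w + Inv (ω · w)
    ≡⟨ cong₂ _+_ (Inv-ΣΣ w) (Inv-ΣΣ (ω · w)) ⟩
      ΣΣ (inv w) + ΣΣ (inv (ω · w))
    ≡⟨ sym (ΣΣ-+ (inv w) (inv (ω · w))) ⟩
      ΣΣ (λ i j → inv w i j + inv (ω · w) i j)
    ≡⟨ ΣΣ-cong (inv-complement w) ⟩
      ΣΣ (inv ω)
    ≡⟨ sym (Inv-ΣΣ ω) ⟩
      Inv ω
    ∎
    where open ≡-Reasoning

  -- w₀ inverts every pair i < j, so it counts the odd-distance pairs of positions.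
  inv-w₀ : (i j : Idx n) → inv ω i j ≡ oddGap (toℕ i) (toℕ j)
  inv-w₀ i j = 𝟙-char (LPair? ω (i , j))
    (oddGap-yes _ _ ∘ to gap) (λ ¬counted → oddGap-no _ _ (¬counted ∘ from gap))
    where
    gap : LPair ω (i , j) ⇔ OddGap (toℕ i) (toℕ j)
    gap = mk⇔ (λ counted → let (lt , dp) = to LPair-w₀ counted in val-<⇒toℕ-< lt , to DiffParity⇔parity dp)
              (λ (lt , odd) → from LPair-w₀ (toℕ-<⇒val-< lt , from DiffParity⇔parity odd))

  Inv-w₀ : Inv ω ≡ suc n C 2 + suc n C 2
  Inv-w₀ = trans (Inv-ΣΣ ω) (trans (ΣΣ-cong inv-w₀) (oddPairs-value n))

  -- With no inversions, w increases on each adjacent pair, hence is the identity.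
  Inv≡0⇒id : (w : B n) → Inv w ≡ 0 → ∀ i → w ⟨ i ⟩ ≡ i
  Inv≡0⇒id w none i =
    FinP.toℕ-injective (increasing⇒toℕ (toℕ ∘ (w ⟨_⟩)) step (λ k → ℕP.≤-pred (FinP.toℕ<n (w ⟨ k ⟩))) i)
    where
    step : ∀ i j → toℕ j ≡ suc (toℕ i) → toℕ (w ⟨ i ⟩) < toℕ (w ⟨ j ⟩)
    step i j adjacent = not-inverted (ℕP.≤-reflexive (sym adjacent)) (adjacent-odd adjacent)
      where
      not-inverted : toℕ i < toℕ j → DiffParity {n} i j → toℕ (w ⟨ i ⟩) < toℕ (w ⟨ j ⟩)
      not-inverted i<j dp with trichotomy (v (w ⟨ i ⟩)) (v (w ⟨ j ⟩))
                                  (λ e → ℕP.<-irrefl (cong toℕ (B-injective w (val-injective e))) i<j)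
      ... | inj₁ increasing = val-<⇒toℕ-< increasing
      ... | inj₂ inverted   = ⊥-elim (1≢0 (trans (sym (𝟙-yes (LPair? w (i , j)) counted)) uncounted))
        where
        counted : LPair w (i , j)
        counted = toℕ-<⇒val-< i<j , inverted , dp
        uncounted : inv w i j ≡ 0
        uncounted = ΣΣ≡0 (inv w) (trans (sym (Inv-ΣΣ w)) none) i j
        1≢0 : 1 ≢ 0
        1≢0 ()

  id⇒Inv≡0 : (w : B n) → (∀ i → w ⟨ i ⟩ ≡ i) → Inv w ≡ 0
  id⇒Inv≡0 w fixed = cong length (ListP.filter-none (LPair? w) {allPairs n} (All.tabulate λ {(i , j)} _ → uncounted))
    where
    uncounted : ∀ {i j} → ¬ LPair w (i , j)
    uncounted {i} {j} (lt , inverted , _) =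
      ℤP.<-asym lt (subst₂ (λ a b → v a ℤ.< v b) (fixed j) (fixed i) inverted)

  L≡0⇔id : (w : B n) → (L w ≡ 0) ⇔ (∀ i → w ⟨ i ⟩ ≡ i)
  L≡0⇔id w = mk⇔ (λ none → Inv≡0⇒id w (trans (Inv-double w) (cong₂ _+_ none none)))
                 (λ fixed → cong ⌊_/2⌋ (id⇒Inv≡0 w fixed))

  L-w₀ : L ω ≡ suc n C 2
  L-w₀ = double-injective (trans (sym (Inv-double ω)) Inv-w₀)

  L-complement : (w : B n) → L w + L (ω · w) ≡ L ω
  L-complement w = double-injective (begin
      (L w + L (ω · w)) + (L w + L (ω · w))
    ≡⟨ interchange (L w) (L (ω · w)) (L w) (L (ω · w)) ⟩
      (L w + L w) + (L (ω · w) + L (ω · w))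
    ≡⟨ sym (cong₂ _+_ (Inv-double w) (Inv-double (ω · w))) ⟩
      Inv w + Inv (ω · w)
    ≡⟨ Inv-complement w ⟩
      Inv ω
    ≡⟨ Inv-double ω ⟩
      L ω + L ω
    ∎)
    where open ≡-Reasoning

  L-w₀w : (w : B n) → L (ω · w) ≡ L ω ∸ L w
  L-w₀w w = trans (sym (ℕP.m+n∸m≡n (L w) (L (ω · w)))) (cong (_∸ L w) (L-complement w))

  L-ww₀ : (w : B n) → L (w · ω) ≡ L ω ∸ L w
  L-ww₀ w = trans (cong ⌊_/2⌋ (Inv-cong (w · ω) (ω · w) (w₀-central w))) (L-w₀w w)

  L≤L-w₀ : (w : B n) → L w ≤ L ω
  L≤L-w₀ w = subst (L w ≤_) (L-complement w) (ℕP.m≤m+n (L w) (L (ω · w)))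

  -- If L w is maximal then w w₀ has length 0, so w w₀ = id and w = w₀.
  L-maximal⇒w₀ : (w : B n) → L w ≡ L ω → ∀ i → w ⟨ i ⟩ ≡ ω ⟨ i ⟩
  L-maximal⇒w₀ w maximal i = begin
      w ⟨ i ⟩
    ≡⟨ cong (w ⟨_⟩) (sym (FinP.opposite-involutive i)) ⟩
      (w · ω) ⟨ opposite i ⟩
    ≡⟨ to (L≡0⇔id (w · ω)) length-zero (opposite i) ⟩
      ω ⟨ i ⟩
    ∎
    where
    open ≡-Reasoning
    length-zero : L (w · ω) ≡ 0
    length-zero = trans (L-ww₀ w) (trans (cong (L ω ∸_) maximal) (ℕP.n∸n≡0 (L ω)))

corollary2p5 : (n : ℕ) →
    ((w : B n) → (L (w · w₀) ≡ L (w₀ {n}) ∸ L w) × (L (w₀ · w) ≡ L (w₀ {n}) ∸ L w))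
    × ((w : B n) → (L w ≡ 0) ⇔ (∀ (i : Idx n) → w ⟨ i ⟩ ≡ i))
    × ((w : B n) → L w ≤ L (w₀ {n}))
    × ((w : B n) → L w ≡ L (w₀ {n}) → ∀ (i : Idx n) → w ⟨ i ⟩ ≡ w₀ {n} ⟨ i ⟩)
    × (L (w₀ {n}) ≡ suc n C 2)
corollary2p5 n = (λ w → L-ww₀ w , L-w₀w w) , L≡0⇔id , L≤L-w₀ , L-maximal⇒w₀ , L-w₀ {n}
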